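{- Let $M=\langle W,\mathrm{av},\mathrm{pv},\mathrm{ob},V\rangle$ be a CJ-model with $W=\{a,b,c\}$ (three distinct worlds), and let $A$ be a formula with $\|A\|=\{a\}$ such that $\bigcirc(A\mid\top)$ is true in $M$. Then for every $X\subseteq W$ with $a\in X$, $\mathrm{ob}(X)=U(\{a\})$, where $U(\{a\})=\{Y\subseteq W:\{a\}\subseteq Y\}$.
   Context: A CJ-model is a tuple $M=\langle W,\mathrm{av},\mathrm{pv},\mathrm{ob},V\rangle$ where $W\neq\emptyset$; $V$ is a valuation assigning to each propositional atom a subset of $W$, extended to all formulas in the usual way, and $\|A\|=\{x\in W: x\models A\}$; $\mathrm{av},\mathrm{pv}:W\to\mathcal P(W)$ with $w\in\mathrm{av}(w)\subseteq\mathrm{pv}(w)$ for all $w$; and $\mathrm{ob}:\mathcal P(W)\to\mathcal P(\mathcal P(W))$ satisfies, for all $X,Y,Z\subseteq W$: (1) $\emptyset\notin\mathrm{ob}(X)$; (2) if $Y\cap X=Z\cap X$ then ($Y\in\mathrm{ob}(X)\iff Z\in\mathrm{ob}(X)$); (3) if $Y,Z\in\mathrm{ob}(X)$ then $Y\cap Z\in\mathrm{ob}(X)$; (4) if $X\subseteq Y\subseteq Z$ and $X\in\mathrm{ob}(Y)$ then $(Z\setminus Y)\cup X\in\mathrm{ob}(Z)$. $\top$ is a tautology, $\|\top\|=W$. Truth condition (independent of the world of evaluation): $\bigcirc(B\mid A)$ is true iff $\|B\|\cap\|A\|\neq\emptyset$ and for every $X\subseteq\|A\|$ with $X\cap\|B\|\neq\emptyset$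 we have $\|B\|\in\mathrm{ob}(X)$. -}

module Defs where

open import Data.Bool using (Bool; true; false; T; if_then_else_)
open import Data.Nat using (ℕ)
open import Data.Fin using (Fin)
open import Data.Fin.Subset using (Subset; _∈_; _⊆_; _∩_; _∪_; _─_; ⊤; ⊥; ∁; Nonempty)
open import Data.Fin.Subset.Properties using (_⊆?_; nonempty?; anySubset?)
open import Data.Product using (Σ; _×_; _,_)
open import Data.Empty using (⊥-elim)
open import Relation.Binary.PropositionalEquality using (_≡_)
open import Relation.Nullary using (Dec; yes; no; ¬_; does)
open import Relation.Nullary.Decidable using (_×-dec_; _→-dec_; ¬?; decidable-stable)
open import Function.Bundles using (_⇔_)

World : Set
World = Fin 3

PW : Set
PW = Subset 3

data Formula : Set where
  atom  : ℕ → Formula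
  ⊤ᶠ    : Formula
  ¬ᶠ_   : Formula → Formula
  _∧ᶠ_  : Formula → Formula → Formula
  ○[_∣_] : Formula → Formula → Formula

-- CJ-model ⟨W, av, pv, ob, V⟩ with W = Fin 3.
-- ob(X) ⊆ P(W) is given by its (decidable, as P(W) is finite) characteristic function:
-- Y ∈ ob(X)  iff  T (ob X Y).
record CJModel : Set where
  field
    av  : World → PW
    pv  : World → PW
    ob  : PW → PW → Bool
    V   : ℕ → PW

  _∈ob_ : PW → PW → Set
  Y ∈ob X = T (ob X Y)

  field
    av-refl : ∀ w → w ∈ av w
    av⊆pv   : ∀ w → av w ⊆ pv w
    ob-1 : ∀ X → ¬ (⊥ ∈ob X)
    ob-2 : ∀ X Y Z → Y ∩ X ≡ Z ∩ X → (Y ∈ob X ⇔ Z ∈ob X)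
    ob-3 : ∀ X Y Z → Y ∈ob X → Z ∈ob X → (Y ∩ Z) ∈ob X
    ob-4 : ∀ X Y Z → X ⊆ Y → Y ⊆ Z → X ∈ob Y → ((Z ─ Y) ∪ X) ∈ob Z

  OCond : PW → PW → Set
  OCond B A = Nonempty (B ∩ A) × (∀ X → X ⊆ A → Nonempty (X ∩ B) → B ∈ob X)

  private
    all? : ∀ {P : PW → Set} → (∀ X → Dec (P X)) → Dec (∀ X → P X)
    all? P? with anySubset? (λ X → ¬? (P? X))
    ... | yes (X , ¬p) = no (λ h → ¬p (h X))
    ... | no  ¬∃     = yes (λ X → decidable-stable (P? X) (λ ¬p → ¬∃ (X , ¬p)))

    ∈ob? : ∀ Y X → Dec (Y ∈ob X)
    ∈ob? Y X with ob X Y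
    ... | true  = yes _
    ... | false = no (λ ())

  OCond? : ∀ B A → Dec (OCond B A)
  OCond? B A = nonempty? (B ∩ A)
    ×-dec all? (λ X → (X ⊆? A) →-dec (nonempty? (X ∩ B) →-dec ∈ob? B X))

  -- Truth set ‖A‖ = {x ∈ W : x ⊨ A}; ○(B ∣ A) is world-independent.
  ‖_‖ : Formula → PW
  ‖ atom p ‖ = V p
  ‖ ⊤ᶠ ‖ = ⊤
  ‖ ¬ᶠ A ‖ = ∁ ‖ A ‖
  ‖ A ∧ᶠ B ‖ = ‖ A ‖ ∩ ‖ B ‖
  ‖ ○[ B ∣ A ] ‖ = if does (OCond? ‖ B ‖ ‖ A ‖) then ⊤ else ⊥

  OTrue : Formula → Formula → Set
  OTrue B A = OCond ‖ B ‖ ‖ A ‖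

U : PW → PW → Set
U S Y = S ⊆ Y

-- Truth of ○(A ∣ ⊤) with ‖A‖ = {a} makes {a} obligatory in every context X ∋ a.
-- Closure under intersection together with ∅ ∉ ob(X) then forces every member of
-- ob(X) to contain a.  Conversely, for a ∈ Y, axiom (4) applied to {a} ⊆ S ⊆ X with
-- S = (X ─ Y) ∪ {a} yields (X ─ S) ∪ {a} ∈ ob(X), and this set agrees with Y on X.
module Submission where

open import Defs
open import Data.Bool using (true; false)
open import Data.Fin using (Fin)
open import Data.Fin.Subset using (Subset; _∈_; _⊆_; _∩_; _∪_; _─_; ⁅_⁆; ⊤; Nonempty)
open import Data.Fin.Subset.Properties
  using (⊆⊤; q⊆p∪q; p─q⊆p; x∈⁅x⁆; x∈⁅y⁆⇒x≡y; x∈p∩q⁺; x∈p∩q⁻; x∈p∪q⁻; drop-∷-⊆;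
         Empty-unique; nonempty?)
open import Data.Product using (_,_)
open import Data.Sum using (inj₁; inj₂)
open import Data.Vec using ([]; _∷_; here)
open import Function.Bundles using (_⇔_; mk⇔; Equivalence)
open import Relation.Binary.PropositionalEquality using (_≡_; refl; cong; sym; subst)
open import Relation.Nullary.Decidable using (decidable-stable)

⁅x⁆⊆p : ∀ {n} {x : Fin n} {p : Subset n} → x ∈ p → ⁅ x ⁆ ⊆ p
⁅x⁆⊆p {x = x} x∈p y∈⁅x⁆ = subst (_∈ _) (sym (x∈⁅y⁆⇒x≡y x y∈⁅x⁆)) x∈p

[p─q]∪r⊆p : ∀ {n} (p q : Subset n) {r : Subset n} → r ⊆ p → (p ─ q) ∪ r ⊆ p
[p─q]∪r⊆p p q r⊆p x∈ with x∈p∪q⁻ (p ─ q) _ x∈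
... | inj₁ x∈p─q = p─q⊆p p q x∈p─q
... | inj₂ x∈r   = r⊆p x∈r

-- Pointwise this is ((x ∧ ¬((x ∧ ¬y) ∨ z)) ∨ z) ∧ x = y ∧ x whenever z ≤ x ∧ y.
[p─[[p─q]∪r]∪r]∩p≡q∩p : ∀ {n} (p q r : Subset n) → r ⊆ p → r ⊆ q →
                         ((p ─ ((p ─ q) ∪ r)) ∪ r) ∩ p ≡ q ∩ p
[p─[[p─q]∪r]∪r]∩p≡q∩p []      []      []      _   _   = refl
[p─[[p─q]∪r]∪r]∩p≡q∩p (x ∷ p) (y ∷ q) (z ∷ r) r⊆p r⊆q
  with [p─[[p─q]∪r]∪r]∩p≡q∩p p q r (drop-∷-⊆ r⊆p) (drop-∷-⊆ r⊆q)
[p─[[p─q]∪r]∪r]∩p≡q∩p (x ∷ p) (y ∷ q) (true ∷ r) r⊆p r⊆q | tail≡ with r⊆p here | r⊆q here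
... | here | here = cong (true ∷_) tail≡
[p─[[p─q]∪r]∪r]∩p≡q∩p (true  ∷ p) (true  ∷ q) (false ∷ r) _ _ | tail≡ = cong (true  ∷_) tail≡
[p─[[p─q]∪r]∪r]∩p≡q∩p (true  ∷ p) (false ∷ q) (false ∷ r) _ _ | tail≡ = cong (false ∷_) tail≡
[p─[[p─q]∪r]∪r]∩p≡q∩p (false ∷ p) (true  ∷ q) (false ∷ r) _ _ | tail≡ = cong (false ∷_) tail≡
[p─[[p─q]∪r]∪r]∩p≡q∩p (false ∷ p) (false ∷ q) (false ∷ r) _ _ | tail≡ = cong (false ∷_) tail≡

module _ (M : CJModel) where
  open CJModel M

  ob-intersecting : ∀ X Y Z → Y ∈ob X → Z ∈ob X → Nonempty (Y ∩ Z)
  ob-intersecting X Y Z Y∈obX Z∈obX = decidable-stable (nonempty? (Y ∩ Z)) λ empty →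
    ob-1 X (subst (_∈ob X) (Empty-unique empty) (ob-3 X Y Z Y∈obX Z∈obX))

  ⁅x⁆∈ob⇒∈ob⇒x∈ : ∀ {x} X Y → ⁅ x ⁆ ∈ob X → Y ∈ob X → x ∈ Y
  ⁅x⁆∈ob⇒∈ob⇒x∈ {x} X Y ⁅x⁆∈obX Y∈obX =
    let y , y∈Y∩⁅x⁆ = ob-intersecting X Y ⁅ x ⁆ Y∈obX ⁅x⁆∈obX
        y∈Y , y∈⁅x⁆ = x∈p∩q⁻ Y ⁅ x ⁆ y∈Y∩⁅x⁆
    in subst (_∈ Y) (x∈⁅y⁆⇒x≡y x y∈⁅x⁆) y∈Y

  ob-upward : ∀ X Y Z → Z ⊆ X → Z ⊆ Y → Z ∈ob ((X ─ Y) ∪ Z) → Y ∈ob X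
  ob-upward X Y Z Z⊆X Z⊆Y Z∈ob =
    Equivalence.to (ob-2 X _ Y ([p─[[p─q]∪r]∪r]∩p≡q∩p X Y Z Z⊆X Z⊆Y))
      (ob-4 Z ((X ─ Y) ∪ Z) X (q⊆p∪q (X ─ Y) Z) ([p─q]∪r⊆p X Y Z⊆X) Z∈ob)

  OCond-⊤⇒∈ob : ∀ B → OCond B ⊤ → ∀ X → Nonempty (X ∩ B) → B ∈ob X
  OCond-⊤⇒∈ob B (_ , obligatory) X = obligatory X ⊆⊤

mainTheorem2 : (M : CJModel) → let open CJModel M in
    (a : World) (A : Formula) → ‖ A ‖ ≡ ⁅ a ⁆ → OTrue A ⊤ᶠ →
    ∀ X → a ∈ X → ∀ Y → (Y ∈ob X ⇔ U ⁅ a ⁆ Y)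
mainTheorem2 M a A ‖A‖≡⁅a⁆ ○A X a∈X Y = mk⇔ only-if if
  where
  open CJModel M

  ⁅a⁆∈ob : ∀ Z → a ∈ Z → ⁅ a ⁆ ∈ob Z
  ⁅a⁆∈ob Z a∈Z = subst (_∈ob Z) ‖A‖≡⁅a⁆
    (OCond-⊤⇒∈ob M ‖ A ‖ ○A Z (a , x∈p∩q⁺ (a∈Z , subst (a ∈_) (sym ‖A‖≡⁅a⁆) (x∈⁅x⁆ a))))

  only-if : Y ∈ob X → ⁅ a ⁆ ⊆ Y
  only-if Y∈obX = ⁅x⁆⊆p (⁅x⁆∈ob⇒∈ob⇒x∈ M X Y (⁅a⁆∈ob X a∈X) Y∈obX)

  if : ⁅ a ⁆ ⊆ Y → Y ∈ob X
  if ⁅a⁆⊆Y = ob-upward M X Y ⁅ a ⁆ (⁅x⁆⊆p a∈X) ⁅a⁆⊆Y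
    (⁅a⁆∈ob ((X ─ Y) ∪ ⁅ a ⁆) (q⊆p∪q (X ─ Y) ⁅ a ⁆ (x∈⁅x⁆ a)))
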